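{- Let $f\colon\mathbb{N}_0\to\mathbb{N}_0$ be a multiplicative arithmetic function (i.e. $f(1)=1$ and $f(mn)=f(m)f(n)$ for coprime $m,n\in\mathbb{N}$) such that for all primes $p$ and positive integers $\alpha$: (I) $f(p^{\alpha})<p^{\alpha}$; (II) $f(p)\mid f(p^{\alpha})$; (III) every prime $q$ dividing $f(p^{\alpha})$ divides $p\,f(p)$; and (IV) $f(0)=0$. Let $T$ be the set of positive integers defined below. Let $k\in\mathbb{N}$. If all the prime divisors of $k$ are in $T$, then all the positive divisors of $k$ (including $k$ itself) are in $T$. Conversely, if $k\in T$, then every positive divisor of $k$ is an element of $T$.
   Context: $T$ is the unique set of positive integers determined by the following criteria: (1) $1\in T$; (2) if $p$ is prime, then $p\in T$ if and only if $f(p)\in T$; (3) if $x$ is composite, then $x\in T$ if and only if there exist $x_1,x_2\in T$ with $x_1,x_2>1$ and $x_1x_2=x$. In particular $0\notin T$. -}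

module Defs where

open import Data.Nat using (ℕ; _*_; _>_)
open import Data.Nat.Primality using (Prime; Composite)
open import Relation.Binary.PropositionalEquality using (_≡_)

-- The set T (depending on f), as the inductively generated (least) set
-- closed under the criteria (1)-(3).  Since f(p) < p for primes p
-- (hypothesis (I)), this is the unique set satisfying (1)-(3); the
-- "only if" directions of (2) and (3) hold by inversion, since primes
-- are not Composite and 1 is neither prime nor composite.
data T (f : ℕ → ℕ) : ℕ → Set where
  T-one   : T f 1
  T-prime : ∀ {p} → Prime p → T f (f p) → T f p
  T-comp  : ∀ {x} x₁ x₂ → Composite x → T f x₁ → T f x₂ →
            x₁ > 1 → x₂ > 1 → x₁ * x₂ ≡ x → T f x

module Submission where

-- Both halves of the lemma reduce to one closure property of
-- T, for which none of the hypotheses on f are needed (they only ensure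
-- that T is well defined, which the inductive definition in Defs does
-- once and for all):
--
--   * `divisors-in-T`: if every prime divisor of k lies in T, then so does
--     every positive divisor d of k.  By strong induction on d: 1 ∈ T, a
--     prime d ∈ T by assumption, and a composite d splits as d = a · b
--     with 1 < a, b < d (`composite-split`), both dividing k, so a, b ∈ T
--     by induction and d ∈ T by rule (3).
--   * `prime-divisors-in-T`: every prime divisor q of an element x ∈ T
--     lies in T.  By induction on the derivation of x ∈ T: x = 1 has no
--     prime divisor, a prime x has q = x, and for x = x₁ · x₂ Euclid's
--     lemma puts q in a factor.

open import Defs
open import Data.Nat using (ℕ; _*_; _^_; _<_; _≥_; suc; NonZero; nonTrivial⇒n>1)
open import Data.Nat.Properties using (<⇒≤)
open import Data.Nat.Divisibility
  using (_∣_; ∣-trans; quotient-∣; quotient>1; quotient-<; m∣n⇒n≡m*quotient; ∣1⇒≡1)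
open import Data.Nat.Coprimality using (Coprime)
open import Data.Nat.Primality
  using (Prime; Composite; composite; composite⇒nonZero; prime?; ¬prime⇒composite; euclidsLemma;
         prime⇒irreducible; ¬prime[1])
open import Data.Nat.Induction using (<-rec)
open import Data.Product using (Σ-syntax; _×_; _,_)
open import Data.Sum using (inj₁; inj₂)
open import Data.Empty using (⊥-elim)
open import Relation.Nullary using (yes; no)
open import Relation.Binary.PropositionalEquality using (_≡_; refl; sym; subst)

composite-split : ∀ {n} → Composite n →
  Σ[ a ∈ ℕ ] Σ[ b ∈ ℕ ] 1 < a × 1 < b × a < n × b < n × a ∣ n × b ∣ n × a * b ≡ n
composite-split n-composite@(composite {a} a<n a∣n) =
  a , _∣_.quotient a∣n , nonTrivial⇒n>1 a , quotient>1 a∣n a<n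
    , a<n , quotient-< a∣n , a∣n , quotient-∣ a∣n , sym (m∣n⇒n≡m*quotient a∣n)
  where instance
  n-nonZero : NonZero _
  n-nonZero = composite⇒nonZero n-composite

divisors-in-T : ∀ f k → (∀ q → Prime q → q ∣ k → T f q) →
  ∀ d → d ≥ 1 → d ∣ k → T f d
divisors-in-T f k primes-in-T = <-rec _ step
  where
  step : ∀ d → (∀ {e} → e < d → e ≥ 1 → e ∣ k → T f e) → d ≥ 1 → d ∣ k → T f d
  step 1 _ _ _ = T-one
  step d@(suc (suc _)) smaller-in-T _ d∣k with prime? d
  ... | yes d-prime = primes-in-T d d-prime d∣k
  ... | no d-not-prime
    with d-composite ← ¬prime⇒composite d-not-prime
    with a , b , 1<a , 1<b , a<d , b<d , a∣d , b∣d , a*b≡d ← composite-split d-composite =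
    T-comp a b d-composite
      (smaller-in-T a<d (<⇒≤ 1<a) (∣-trans a∣d d∣k))
      (smaller-in-T b<d (<⇒≤ 1<b) (∣-trans b∣d d∣k))
      1<a 1<b a*b≡d

prime-divisors-in-T : ∀ {f x q} → T f x → Prime q → q ∣ x → T f q
prime-divisors-in-T T-one q-prime q∣1 =
  ⊥-elim (¬prime[1] (subst Prime (∣1⇒≡1 q∣1) q-prime))
prime-divisors-in-T x∈T@(T-prime x-prime _) q-prime q∣x
  with prime⇒irreducible x-prime q∣x
... | inj₁ q≡1 = ⊥-elim (¬prime[1] (subst Prime q≡1 q-prime))
... | inj₂ refl = x∈T
prime-divisors-in-T (T-comp x₁ x₂ _ x₁∈T x₂∈T _ _ refl) q-prime q∣x
  with euclidsLemma x₁ x₂ q-prime q∣x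
... | inj₁ q∣x₁ = prime-divisors-in-T x₁∈T q-prime q∣x₁
... | inj₂ q∣x₂ = prime-divisors-in-T x₂∈T q-prime q∣x₂

lemma1p1 : (f : ℕ → ℕ) →
    f 1 ≡ 1 →
    (∀ m n → m ≥ 1 → n ≥ 1 → Coprime m n → f (m * n) ≡ f m * f n) →
    (∀ p α → Prime p → α ≥ 1 → f (p ^ α) < p ^ α) →
    (∀ p α → Prime p → α ≥ 1 → f p ∣ f (p ^ α)) →
    (∀ p α q → Prime p → α ≥ 1 → Prime q → q ∣ f (p ^ α) → q ∣ p * f p) →
    f 0 ≡ 0 →
    (k : ℕ) → k ≥ 1 →
    ((∀ q → Prime q → q ∣ k → T f q) → ∀ d → d ≥ 1 → d ∣ k → T f d)
    × (T f k → ∀ d → d ≥ 1 → d ∣ k → T f d)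
lemma1p1 f _ _ _ _ _ _ k _ =
  divisors-in-T f k ,
  λ k∈T → divisors-in-T f k (λ q q-prime q∣k → prime-divisors-in-T k∈T q-prime q∣k)
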